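{- Let $p$ be a prime and let $G$ be a finite abelian $p$-group of order $p^n$ and exponent $p^\lambda$. Then for every $0\le j\le \lambda$, \[ \frac{N(p^j,G)}{p^j}\le p^{\,n-\lambda}, \] and $N(G)\le \tau(p^\lambda)\,p^{\,n-\lambda}$.
   Context: For a finite abelian group $G$ and a positive integer $d$, $N(d,G)$ denotes the number of elements of $G$ of order exactly $d$, and $N(G)=\sum_{d\mid \#G} N(d,G)/d$. $\tau(m)$ denotes the number of positive divisors of $m$. -}

module Defs where

open import Level using (Level; _⊔_) renaming (suc to lsuc)
open import Algebra.Bundles using (AbelianGroup)
open import Data.Nat as ℕ using (ℕ; zero; suc; _<_; _<?_; _≤_)
open import Data.Nat.Divisibility using (_∣_; _∣?_)
open import Data.Fin using (Fin; toℕ)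
open import Data.Fin.Properties using (all?)
open import Data.List using (List; filter; length; applyUpTo; allFin; map; foldr)
open import Data.Product using (∃; _×_; _,_)
open import Data.Integer using (+_)
open import Data.Rational as ℚ using (ℚ; 0ℚ)
open import Relation.Nullary using (¬_; Dec)
open import Relation.Nullary.Decidable using (_×-dec_; ¬?; _→-dec_)
open import Relation.Binary.PropositionalEquality using (_≡_)
import Relation.Binary.Definitions as RD

record FiniteAbelianGroup (c ℓ : Level) : Set (lsuc (c ⊔ ℓ)) where
  field
    abGroup : AbelianGroup c ℓ
  open AbelianGroup abGroup public
  field
    _≟_       : RD.Decidable _≈_
    size      : ℕ
    enum      : Fin size → Carrier
    enum-surj : ∀ x → ∃ λ i → enum i ≈ x
    enum-inj  : ∀ i j → enum i ≈ enum j → i ≡ j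

module _ {c ℓ : Level} (G : FiniteAbelianGroup c ℓ) where
  open FiniteAbelianGroup G

  pow : Carrier → ℕ → Carrier
  pow x zero    = ε
  pow x (suc k) = x ∙ pow x k

  HasOrder : Carrier → ℕ → Set ℓ
  HasOrder x d = (0 < d) × (pow x d ≈ ε) ×
                 ((k : Fin d) → 0 < toℕ k → ¬ (pow x (toℕ k) ≈ ε))

  hasOrder? : ∀ x d → Dec (HasOrder x d)
  hasOrder? x d = (0 <? d) ×-dec ((pow x d ≟ ε) ×-dec
                  all? (λ k → (0 <? toℕ k) →-dec ¬? (pow x (toℕ k) ≟ ε)))

  N : ℕ → ℕ
  N d = length (filter (λ i → hasOrder? (enum i) d) (allFin size))

  IsExponent : ℕ → Set (c ⊔ ℓ)
  IsExponent e = (0 < e) × (∀ x → pow x e ≈ ε) ×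
                 (∀ k → 0 < k → (∀ x → pow x k ≈ ε) → e ≤ k)

divisors : ℕ → List ℕ
divisors m = filter (_∣? m) (applyUpTo suc m)

τ : ℕ → ℕ
τ m = length (divisors m)

-- a / b as a rational; the b = 0 case is never used (b ranges over positive divisors)
frac : ℕ → ℕ → ℚ
frac a zero    = 0ℚ
frac a (suc b) = (+ a) ℚ./ suc b

ℕtoℚ : ℕ → ℚ
ℕtoℚ a = (+ a) ℚ./ 1

sumℚ : List ℚ → ℚ
sumℚ = foldr ℚ._+_ 0ℚ

NG : ∀ {c ℓ} → FiniteAbelianGroup c ℓ → ℚ
NG G = sumℚ (map (λ d → frac (N G d) d) (divisors (FiniteAbelianGroup.size G)))

module Submission where

-- Let E be the exponent of G and g an element of order E (in a p-group some element attains the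
-- exponent).  For d k = E, the translates a g^t with a^d = 1 and 0 ≤ t < k are pairwise distinct:
-- a g^t = a' g^(t+s) forces (g^s)^d = 1, hence E ∣ d s and k ∣ s.  So the d-torsion has at most
-- |G| / k = d |G| / E elements, which bounds N(d,G) / d by |G| / E.  Only divisors d of E carry
-- elements of order d, and there are τ(E) of them.

open import Defs
open import Level using (Level)
open import Function using (_∘_)
open import Data.Nat as ℕ using (ℕ; zero; suc; _+_; _*_; _∸_; _^_; _<_; _≤_; z≤n; s≤s; NonZero)
import Data.Nat.Properties as ℕ
open import Data.Nat.Divisibility
  using (_∣_; divides; _∣?_; ∣⇒≤; >⇒∤; m∣m*n; *-monoˡ-∣; *-cancelʳ-∣; *-cancelˡ-∣; 1∣_; 0∣⇒≡0; ∣1⇒≡1)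
open import Data.Nat.GCD using (gcd; gcd-GCD; gcd[m,n]∣m; gcd[m,n]∣n; gcd[m,n]≢0; module Bézout)
open import Data.Nat.Coprimality using (Coprime; coprime-divisor)
open import Data.Nat.Primality using (Prime; prime⇒irreducible; prime⇒nonTrivial)
open import Data.Integer using (1ℤ)
import Data.Integer as ℤ
import Data.Integer.Properties as ℤ
open import Data.Rational as ℚ using (ℚ)
import Data.Rational.Properties as ℚ
open import Data.Rational.Unnormalised as ℚᵘ using (mkℚᵘ; *≤*; *≡*)
import Data.Rational.Unnormalised.Properties as ℚᵘ
open import Data.Fin using (Fin; zero; suc; toℕ; fromℕ<; remQuot; combine)
import Data.Fin.Properties as Fin
open import Data.List using (List; []; _∷_; [_]; _++_; allFin; length; lookup; filter; applyUpTo; map)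
import Data.List.Properties as List
open import Data.List.Relation.Unary.All as All using (All; []; _∷_)
import Data.List.Relation.Unary.All.Properties as All
open import Data.List.Relation.Unary.AllPairs using ([]; _∷_)
open import Data.List.Relation.Unary.Unique.Propositional using (Unique)
import Data.List.Relation.Unary.Unique.Propositional.Properties as Unique
open import Data.List.Membership.Propositional.Properties using (∈-lookup)
import Data.List.Relation.Binary.Sublist.Propositional.Properties as Sublist
open import Data.Product using (∃; _×_; _,_; proj₁; proj₂; uncurry; map₂)
open import Data.Product.Properties using (×-≡,≡→≡)
open import Data.Sum using (_⊎_; inj₁; inj₂)
open import Data.Empty using (⊥-elim)
open import Relation.Nullary using (¬_; yes; no)
open import Relation.Unary using (Pred; Decidable)
open import Relation.Binary.PropositionalEquality as ≡ using (_≡_; _≢_; refl)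

∣∧<⇒≡0 : ∀ {k s} → k ∣ s → s < k → s ≡ 0
∣∧<⇒≡0 {s = zero}  _   _   = refl
∣∧<⇒≡0 {s = suc _} k∣s s<k = ⊥-elim (>⇒∤ s<k k∣s)

^-split : ∀ p {e n} → e ≤ n → p ^ n ≡ p ^ e * p ^ (n ∸ e)
^-split p {e} e≤n = ≡.trans (≡.cong (p ^_) (≡.sym (ℕ.m+[n∸m]≡n e≤n))) (ℕ.^-distribˡ-+-* p e (_ ∸ e))

^-monoʳ-∣ : ∀ p {j e} → j ≤ e → p ^ j ∣ p ^ e
^-monoʳ-∣ p j≤e = ≡.subst (_ ∣_) (≡.sym (^-split p j≤e)) (m∣m*n _)

^-cancelˡ-≤ : ∀ {p m n} → 1 < p → p ^ m ≤ p ^ n → m ≤ n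
^-cancelˡ-≤ {p} 1<p pᵐ≤pⁿ = ℕ.≮⇒≥ (λ n<m → ℕ.<⇒≱ (ℕ.^-monoʳ-< p 1<p n<m) pᵐ≤pⁿ)

prime∤⇒coprime : ∀ {p o} → Prime p → ¬ p ∣ o → Coprime o p
prime∤⇒coprime p-prime p∤o (i∣o , i∣p) with prime⇒irreducible p-prime i∣p
... | inj₁ i≡1 = i≡1
... | inj₂ refl = ⊥-elim (p∤o i∣o)

∣p^[1+e]⇒≡∨∣p^e : ∀ {p} → Prime p → ∀ e {o} → o ∣ p ^ suc e → o ≡ p ^ suc e ⊎ o ∣ p ^ e
∣p^[1+e]⇒≡∨∣p^e {p} p-prime e {o} o∣p^[1+e] with p ∣? o
... | no p∤o = inj₂ (coprime-divisor (prime∤⇒coprime p-prime p∤o) o∣p^[1+e])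
... | yes (divides q refl) =
  multiply-by-p e (*-cancelʳ-∣ p (≡.subst (q * p ∣_) (ℕ.*-comm p (p ^ e)) o∣p^[1+e]))
  where
  instance _ = ℕ.nonTrivial⇒nonZero p {{prime⇒nonTrivial p-prime}}
  multiply-by-p : ∀ e → q ∣ p ^ e → q * p ≡ p ^ suc e ⊎ q * p ∣ p ^ e
  multiply-by-p zero    q∣1 = inj₁ (≡.trans (≡.cong (_* p) (∣1⇒≡1 q∣1)) (ℕ.*-comm 1 p))
  multiply-by-p (suc e) q∣p^[1+e] with ∣p^[1+e]⇒≡∨∣p^e p-prime e q∣p^[1+e]
  ... | inj₁ refl  = inj₁ (ℕ.*-comm (p ^ suc e) p)
  ... | inj₂ q∣p^e = inj₂ (≡.subst (q * p ∣_) (ℕ.*-comm (p ^ e) p) (*-monoˡ-∣ p q∣p^e))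

lookup-injective : ∀ {a} {A : Set a} {xs : List A} → Unique xs →
                   ∀ i j → lookup xs i ≡ lookup xs j → i ≡ j
lookup-injective (_ ∷ _)     zero    zero    _  = refl
lookup-injective (x∉xs ∷ _)  zero    (suc j) eq = ⊥-elim (All.lookup x∉xs (∈-lookup j) eq)
lookup-injective (x∉xs ∷ _)  (suc i) zero    eq = ⊥-elim (All.lookup x∉xs (∈-lookup i) (≡.sym eq))
lookup-injective (_ ∷ uniq) (suc i) (suc j) eq = ≡.cong suc (lookup-injective uniq i j eq)

filter-∣?-applyUpTo : ∀ E .{{_ : NonZero E}} m →
                      filter (_∣? E) (applyUpTo suc (E + m)) ≡ filter (_∣? E) (applyUpTo suc E)
filter-∣?-applyUpTo E zero    = ≡.cong (λ k → filter (_∣? E) (applyUpTo suc k)) (ℕ.+-identityʳ E)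
filter-∣?-applyUpTo E (suc m) = begin
  filter (_∣? E) (applyUpTo suc (E + suc m))
    ≡⟨ ≡.cong (λ k → filter (_∣? E) (applyUpTo suc k)) (ℕ.+-suc E m) ⟩
  filter (_∣? E) (applyUpTo suc (suc (E + m)))
    ≡⟨ ≡.cong (filter (_∣? E)) (List.applyUpTo-∷ʳ suc (E + m)) ⟨
  filter (_∣? E) (applyUpTo suc (E + m) ++ [ suc (E + m) ])
    ≡⟨ List.filter-++ (_∣? E) (applyUpTo suc (E + m)) [ suc (E + m) ] ⟩
  filter (_∣? E) (applyUpTo suc (E + m)) ++ filter (_∣? E) [ suc (E + m) ]
    ≡⟨ ≡.cong (filter (_∣? E) (applyUpTo suc (E + m)) ++_) (List.filter-reject (_∣? E) too-big) ⟩
  filter (_∣? E) (applyUpTo suc (E + m)) ++ []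
    ≡⟨ List.++-identityʳ _ ⟩
  filter (_∣? E) (applyUpTo suc (E + m))
    ≡⟨ filter-∣?-applyUpTo E m ⟩
  filter (_∣? E) (applyUpTo suc E) ∎
  where
  open ≡.≡-Reasoning
  too-big : ¬ suc (E + m) ∣ E
  too-big = >⇒∤ (s≤s (ℕ.m≤m+n E m))

length-divisors-∣ : ∀ {E m} .{{_ : NonZero E}} → E ≤ m → length (filter (_∣? E) (divisors m)) ≤ τ E
length-divisors-∣ {E} {m} E≤m = begin
  length (filter (_∣? E) (filter (_∣? m) (applyUpTo suc m)))
    ≤⟨ Sublist.length-mono-≤ (Sublist.filter⁺ (_∣? E) (_∣? E) (λ { refl d∣E → d∣E })
                                (Sublist.filter-⊆ (_∣? m) (applyUpTo suc m))) ⟩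
  length (filter (_∣? E) (applyUpTo suc m))
    ≡⟨ ≡.cong (λ k → length (filter (_∣? E) (applyUpTo suc k))) (ℕ.m+[n∸m]≡n E≤m) ⟨
  length (filter (_∣? E) (applyUpTo suc (E + (m ∸ E))))
    ≡⟨ ≡.cong length (filter-∣?-applyUpTo E (m ∸ E)) ⟩
  τ E ∎
  where open ℕ.≤-Reasoning

frac≤ℕtoℚ : ∀ a b c → a ≤ suc b * c → frac a (suc b) ℚ.≤ ℕtoℚ c
frac≤ℕtoℚ a b c a≤[1+b]c = ℚ.toℚᵘ-cancel-≤
  (ℚᵘ.≤-respˡ-≃ (ℚᵘ.≃-sym (ℚ.toℚᵘ-fromℚᵘ (mkℚᵘ (ℤ.+ a) b)))
  (ℚᵘ.≤-respʳ-≃ (ℚᵘ.≃-sym (ℚ.toℚᵘ-fromℚᵘ (mkℚᵘ (ℤ.+ c) 0)))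
  (*≤* (≡.subst₂ ℤ._≤_ (ℤ.pos-* a 1) (ℤ.pos-* c (suc b))
     (ℤ.+≤+ (≡.subst₂ _≤_ (≡.sym (ℕ.*-identityʳ a)) (ℕ.*-comm (suc b) c) a≤[1+b]c))))))

ℕtoℚ-mono-≤ : ∀ {a c} → a ≤ c → ℕtoℚ a ℚ.≤ ℕtoℚ c
ℕtoℚ-mono-≤ {a} {c} a≤c = frac≤ℕtoℚ a 0 c (≡.subst (a ≤_) (≡.sym (ℕ.+-identityʳ c)) a≤c)

ℕtoℚ-homo-+ : ∀ a b → ℕtoℚ (a + b) ≡ ℕtoℚ a ℚ.+ ℕtoℚ b
ℕtoℚ-homo-+ a b = ℚ.toℚᵘ-injective (begin
  ℚ.toℚᵘ (ℕtoℚ (a + b))                 ≈⟨ ℚ.toℚᵘ-fromℚᵘ (mkℚᵘ (ℤ.+ (a + b)) 0) ⟩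
  mkℚᵘ (ℤ.+ (a + b)) 0                  ≈⟨ *≡* cross-multiplied ⟩
  mkℚᵘ (ℤ.+ a) 0 ℚᵘ.+ mkℚᵘ (ℤ.+ b) 0    ≈⟨ ℚᵘ.+-cong (ℚ.toℚᵘ-fromℚᵘ (mkℚᵘ (ℤ.+ a) 0))
                                                    (ℚ.toℚᵘ-fromℚᵘ (mkℚᵘ (ℤ.+ b) 0)) ⟨
  ℚ.toℚᵘ (ℕtoℚ a) ℚᵘ.+ ℚ.toℚᵘ (ℕtoℚ b)  ≈⟨ ℚ.toℚᵘ-homo-+ (ℕtoℚ a) (ℕtoℚ b) ⟨
  ℚ.toℚᵘ (ℕtoℚ a ℚ.+ ℕtoℚ b)            ∎)
  where
  open import Relation.Binary.Reasoning.Setoid ℚᵘ.≃-setoid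
  cross-multiplied : ℤ.+ (a + b) ℤ.* 1ℤ ≡ (ℤ.+ a ℤ.* 1ℤ ℤ.+ ℤ.+ b ℤ.* 1ℤ) ℤ.* 1ℤ
  cross-multiplied rewrite ℤ.*-identityʳ (ℤ.+ (a + b)) | ℤ.*-identityʳ (ℤ.+ a) | ℤ.*-identityʳ (ℤ.+ b)
                         | ℤ.*-identityʳ (ℤ.+ a ℤ.+ ℤ.+ b) = ℤ.pos-+ a b

sumℚ-≤-count : ∀ {a p} {A : Set a} {P : Pred A p} (P? : Decidable P) (f : A → ℚ) X →
               (∀ x → P x → f x ℚ.≤ ℕtoℚ X) → (∀ x → ¬ P x → f x ℚ.≤ ℕtoℚ 0) →
               ∀ xs → sumℚ (map f xs) ℚ.≤ ℕtoℚ (length (filter P? xs) * X)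
sumℚ-≤-count P? f X on-P off-P []       = ℚ.≤-refl
sumℚ-≤-count P? f X on-P off-P (x ∷ xs) with ih ← sumℚ-≤-count P? f X on-P off-P xs | P? x
... | yes Px = ≡.subst (sumℚ (map f (x ∷ xs)) ℚ.≤_) (≡.sym (ℕtoℚ-homo-+ X (length (filter P? xs) * X)))
                 (ℚ.+-mono-≤ (on-P x Px) ih)
... | no ¬Px = ≡.subst (sumℚ (map f (x ∷ xs)) ℚ.≤_) (≡.sym (ℕtoℚ-homo-+ 0 (length (filter P? xs) * X)))
                 (ℚ.+-mono-≤ (off-P x ¬Px) ih)

module _ {c ℓ : Level} (G : FiniteAbelianGroup c ℓ) where
  open FiniteAbelianGroup G renaming (refl to ≈-refl)
  open import Algebra.Properties.AbelianGroup abGroup using (∙-cancelʳ)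
  open import Algebra.Properties.CommutativeMonoid.Mult commutativeMonoid
    using (×-homo-+; ×-assocˡ; ×-distrib-+) renaming (_×_ to _×ᴹ_)
  import Relation.Binary.Reasoning.Setoid setoid as ≈-Reasoning

  infixr 8 _^ᴳ_
  _^ᴳ_ : Carrier → ℕ → Carrier
  x ^ᴳ n = pow G x n

  ^ᴳ≡× : ∀ x n → x ^ᴳ n ≡ n ×ᴹ x
  ^ᴳ≡× x zero    = ≡.refl
  ^ᴳ≡× x (suc n) = ≡.cong (x ∙_) (^ᴳ≡× x n)

  ^ᴳ-homo-+ : ∀ x m n → x ^ᴳ (m + n) ≈ x ^ᴳ m ∙ x ^ᴳ n
  ^ᴳ-homo-+ x m n rewrite ^ᴳ≡× x (m + n) | ^ᴳ≡× x m | ^ᴳ≡× x n = ×-homo-+ x m n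

  ^ᴳ-distrib-∙ : ∀ x y n → (x ∙ y) ^ᴳ n ≈ x ^ᴳ n ∙ y ^ᴳ n
  ^ᴳ-distrib-∙ x y n rewrite ^ᴳ≡× (x ∙ y) n | ^ᴳ≡× x n | ^ᴳ≡× y n = ×-distrib-+ x y n

  ^ᴳ-assoc : ∀ x m n → (x ^ᴳ n) ^ᴳ m ≈ x ^ᴳ (m * n)
  ^ᴳ-assoc x m n rewrite ^ᴳ≡× (x ^ᴳ n) m | ^ᴳ≡× x n | ^ᴳ≡× x (m * n) = ×-assocˡ x m n

  ^ᴳ-congˡ : ∀ {x y} n → x ≈ y → x ^ᴳ n ≈ y ^ᴳ n
  ^ᴳ-congˡ zero    x≈y = ≈-refl
  ^ᴳ-congˡ (suc n) x≈y = ∙-cong x≈y (^ᴳ-congˡ n x≈y)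

  ε^ᴳ : ∀ n → ε ^ᴳ n ≈ ε
  ε^ᴳ zero    = ≈-refl
  ε^ᴳ (suc n) = trans (identityˡ _) (ε^ᴳ n)

  ^ᴳ≈ε-∣ : ∀ {x m n} → m ∣ n → x ^ᴳ m ≈ ε → x ^ᴳ n ≈ ε
  ^ᴳ≈ε-∣ {x} {m} (divides q refl) xᵐ≈ε = begin
    x ^ᴳ (q * m)  ≈⟨ ^ᴳ-assoc x q m ⟨
    (x ^ᴳ m) ^ᴳ q ≈⟨ ^ᴳ-congˡ q xᵐ≈ε ⟩
    ε ^ᴳ q        ≈⟨ ε^ᴳ q ⟩
    ε             ∎
    where open ≈-Reasoning

  ^ᴳ≈ε-cancelʳ : ∀ {x} t s → x ^ᴳ (t + s) ≈ ε → x ^ᴳ s ≈ ε → x ^ᴳ t ≈ ε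
  ^ᴳ≈ε-cancelʳ {x} t s xᵗ⁺ˢ≈ε xˢ≈ε = begin
    x ^ᴳ t            ≈⟨ identityʳ _ ⟨
    x ^ᴳ t ∙ ε        ≈⟨ ∙-congˡ xˢ≈ε ⟨
    x ^ᴳ t ∙ x ^ᴳ s   ≈⟨ ^ᴳ-homo-+ x t s ⟨
    x ^ᴳ (t + s)      ≈⟨ xᵗ⁺ˢ≈ε ⟩
    ε                 ∎
    where open ≈-Reasoning

  ^ᴳ≈ε-gcd : ∀ {x} a b → x ^ᴳ a ≈ ε → x ^ᴳ b ≈ ε → x ^ᴳ gcd a b ≈ ε
  ^ᴳ≈ε-gcd a b xᵃ≈ε xᵇ≈ε with Bézout.identity (gcd-GCD a b)
  ... | Bézout.+- u v eq = ^ᴳ≈ε-cancelʳ (gcd a b) (v * b)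
          (^ᴳ≈ε-∣ (divides u eq) xᵃ≈ε) (^ᴳ≈ε-∣ (divides v refl) xᵇ≈ε)
  ... | Bézout.-+ u v eq = ^ᴳ≈ε-cancelʳ (gcd a b) (u * a)
          (^ᴳ≈ε-∣ (divides v eq) xᵇ≈ε) (^ᴳ≈ε-∣ (divides u refl) xᵃ≈ε)

  ^ᴳ≈ε-quotient : ∀ {a b x} n → a ≈ b ∙ x → a ^ᴳ n ≈ ε → b ^ᴳ n ≈ ε → x ^ᴳ n ≈ ε
  ^ᴳ≈ε-quotient {a} {b} {x} n a≈bx aⁿ≈ε bⁿ≈ε = begin
    x ^ᴳ n            ≈⟨ identityˡ _ ⟨
    ε ∙ x ^ᴳ n        ≈⟨ ∙-congʳ bⁿ≈ε ⟨
    b ^ᴳ n ∙ x ^ᴳ n   ≈⟨ ^ᴳ-distrib-∙ b x n ⟨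
    (b ∙ x) ^ᴳ n      ≈⟨ ^ᴳ-congˡ n a≈bx ⟨
    a ^ᴳ n            ≈⟨ aⁿ≈ε ⟩
    ε                 ∎
    where open ≈-Reasoning

  HasOrder⇒∣ : ∀ {x d m} → HasOrder G x d → x ^ᴳ m ≈ ε → d ∣ m
  HasOrder⇒∣ {x} {d} {m} (0<d , xᵈ≈ε , minimal) xᵐ≈ε = ≡.subst (_∣ m) gcd≡d (gcd[m,n]∣n d m)
    where
    instance _ = ℕ.>-nonZero 0<d
    gcd>0 : 0 < gcd d m
    gcd>0 = ℕ.n≢0⇒n>0 (gcd[m,n]≢0 d m (inj₁ (ℕ.n>0⇒n≢0 0<d)))
    gcd≡d : gcd d m ≡ d
    gcd≡d with ℕ.m≤n⇒m<n∨m≡n (∣⇒≤ (gcd[m,n]∣m d m))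
    ... | inj₂ gcd≡d = gcd≡d
    ... | inj₁ gcd<d = ⊥-elim (≡.subst (λ t → 0 < t → ¬ x ^ᴳ t ≈ ε) (Fin.toℕ-fromℕ< gcd<d)
                                 (minimal (fromℕ< gcd<d)) gcd>0 (^ᴳ≈ε-gcd d m xᵈ≈ε xᵐ≈ε))

  index : Carrier → Fin size
  index x = proj₁ (enum-surj x)

  enum-index : ∀ x → enum (index x) ≈ x
  enum-index x = proj₂ (enum-surj x)

  index-injective : ∀ {x y} → index x ≡ index y → x ≈ y
  index-injective {x} {y} eq =
    trans (sym (enum-index x)) (trans (reflexive (≡.cong enum eq)) (enum-index y))

  _∣Order_ : ℕ → Carrier → Set ℓ
  E ∣Order g = ∀ m → g ^ᴳ m ≈ ε → E ∣ m

  module _ {E g} (E∣ord : E ∣Order g) {d k} .{{_ : NonZero d}} (dk≡E : d * k ≡ E) where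

    translate-gap : ∀ {a a'} → a ^ᴳ d ≈ ε → a' ^ᴳ d ≈ ε →
                    ∀ t s → a ∙ g ^ᴳ t ≈ a' ∙ g ^ᴳ (t + s) → k ∣ s
    translate-gap {a} {a'} aᵈ≈ε a'ᵈ≈ε t s eq =
      *-cancelˡ-∣ d (≡.subst (_∣ d * s) (≡.sym dk≡E) (E∣ord (d * s) gᵈˢ≈ε))
      where
      open ≈-Reasoning
      a≈a'gˢ : a ≈ a' ∙ g ^ᴳ s
      a≈a'gˢ = ∙-cancelʳ (g ^ᴳ t) a (a' ∙ g ^ᴳ s) (begin
        a ∙ g ^ᴳ t               ≈⟨ eq ⟩
        a' ∙ g ^ᴳ (t + s)        ≈⟨ ∙-congˡ (trans (^ᴳ-homo-+ g t s) (comm _ _)) ⟩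
        a' ∙ (g ^ᴳ s ∙ g ^ᴳ t)   ≈⟨ assoc _ _ _ ⟨
        (a' ∙ g ^ᴳ s) ∙ g ^ᴳ t   ∎)
      gᵈˢ≈ε : g ^ᴳ (d * s) ≈ ε
      gᵈˢ≈ε = trans (sym (^ᴳ-assoc g d s)) (^ᴳ≈ε-quotient d a≈a'gˢ aᵈ≈ε a'ᵈ≈ε)

    translate-injective-≤ : ∀ {a a' t t'} → a ^ᴳ d ≈ ε → a' ^ᴳ d ≈ ε → t ≤ t' → t' < k →
                            a ∙ g ^ᴳ t ≈ a' ∙ g ^ᴳ t' → t ≡ t'
    translate-injective-≤ {a} {a'} {t} {t'} aᵈ≈ε a'ᵈ≈ε t≤t' t'<k eq =
      ≡.trans (≡.sym (ℕ.+-identityʳ t)) (≡.trans (≡.cong (t +_) (≡.sym gap≡0)) t+gap≡t')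
      where
      t+gap≡t' : t + (t' ∸ t) ≡ t'
      t+gap≡t' = ℕ.m+[n∸m]≡n t≤t'
      gap≡0 : t' ∸ t ≡ 0
      gap≡0 = ∣∧<⇒≡0
        (translate-gap aᵈ≈ε a'ᵈ≈ε t (t' ∸ t)
          (trans eq (∙-congˡ (reflexive (≡.cong (g ^ᴳ_) (≡.sym t+gap≡t'))))))
        (ℕ.≤-<-trans (ℕ.m∸n≤m t' t) t'<k)

    translate-injective : ∀ {a a' t t'} → a ^ᴳ d ≈ ε → a' ^ᴳ d ≈ ε → t < k → t' < k →
                          a ∙ g ^ᴳ t ≈ a' ∙ g ^ᴳ t' → t ≡ t'
    translate-injective {t = t} {t'} aᵈ≈ε a'ᵈ≈ε t<k t'<k eq with ℕ.≤-total t t'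
    ... | inj₁ t≤t' = translate-injective-≤ aᵈ≈ε a'ᵈ≈ε t≤t' t'<k eq
    ... | inj₂ t'≤t = ≡.sym (translate-injective-≤ a'ᵈ≈ε aᵈ≈ε t'≤t t<k (sym eq))

    torsion-count : (L : List (Fin size)) → Unique L → All (λ i → enum i ^ᴳ d ≈ ε) L →
                    length L * k ≤ size
    torsion-count L uniq torsion =
      Fin.injective⇒≤ {f = index ∘ translate ∘ remQuot {length L} k} injective
      where
      translate : Fin (length L) × Fin k → Carrier
      translate (i , u) = enum (lookup L i) ∙ g ^ᴳ toℕ u
      translate-inj : ∀ {p q} → translate p ≈ translate q → p ≡ q
      translate-inj {i , u} {i′ , u′} eq = ×-≡,≡→≡ (i≡i′ , Fin.toℕ-injective t≡t′)
        where
        member : ∀ i → enum (lookup L i) ^ᴳ d ≈ ε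
        member i = All.lookup torsion (∈-lookup i)
        t≡t′ : toℕ u ≡ toℕ u′
        t≡t′ = translate-injective (member i) (member i′) (Fin.toℕ<n u) (Fin.toℕ<n u′) eq
        i≡i′ : i ≡ i′
        i≡i′ = lookup-injective uniq i i′ (enum-inj _ _
                 (∙-cancelʳ (g ^ᴳ toℕ u) (enum (lookup L i)) (enum (lookup L i′))
                   (trans eq (∙-congˡ (reflexive (≡.cong (g ^ᴳ_) (≡.sym t≡t′)))))))
      injective : ∀ {z z′} → index (translate (remQuot k z)) ≡ index (translate (remQuot k z′)) → z ≡ z′
      injective {z} {z′} eq =
        ≡.trans (≡.sym (Fin.combine-remQuot {length L} k z))
          (≡.trans (≡.cong (uncurry combine) (translate-inj (index-injective eq)))
            (Fin.combine-remQuot {length L} k z′))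

  ∣Order⇒≤size : ∀ {E g} → E ∣Order g → E ≤ size
  ∣Order⇒≤size {E} E∣ord = ≡.subst (_≤ size) (ℕ.+-identityʳ E)
    (torsion-count E∣ord {1} {E} (ℕ.*-identityˡ E) [ index ε ] ([] ∷ [])
      (trans (identityʳ _) (enum-index ε) ∷ []))

  N*k≤size : ∀ {E g} → E ∣Order g → ∀ {d k} .{{_ : NonZero d}} → d * k ≡ E → N G d * k ≤ size
  N*k≤size E∣ord {d} dk≡E = torsion-count E∣ord dk≡E (filter has-order? (allFin size))
    (Unique.filter⁺ has-order? (Unique.allFin⁺ size))
    (All.map (λ order → proj₁ (proj₂ order)) (All.all-filter has-order? (allFin size)))
    where
    has-order? : Decidable (λ i → HasOrder G (enum i) d)
    has-order? i = hasOrder? G (enum i) d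

  N≡0 : ∀ {E d} → (∀ x → x ^ᴳ E ≈ ε) → ¬ d ∣ E → N G d ≡ 0
  N≡0 {E} {d} annihilates d∤E = ≡.cong length (List.filter-none (λ i → hasOrder? G (enum i) d)
    (All.universal (λ i order → d∤E (HasOrder⇒∣ order (annihilates (enum i)))) (allFin size)))

  non-annihilated : ∀ {E k} → IsExponent G E → 0 < k → k < E → ∃ λ x → ¬ x ^ᴳ k ≈ ε
  non-annihilated {E} {k} (_ , _ , minimal) 0<k k<E =
    let i , ¬kills = Fin.¬∀⟶∃¬ size (λ i → enum i ^ᴳ k ≈ ε) (λ i → (enum i ^ᴳ k) ≟ ε) not-all
    in enum i , ¬kills
    where
    not-all : ¬ (∀ i → enum i ^ᴳ k ≈ ε)
    not-all kills = ℕ.<⇒≱ k<E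
      (minimal k 0<k (λ x → trans (^ᴳ-congˡ k (sym (enum-index x))) (kills (index x))))

  p^[1+e]∣Order : ∀ {p e g} → Prime p →
                  g ^ᴳ p ^ suc e ≈ ε → ¬ g ^ᴳ p ^ e ≈ ε → (p ^ suc e) ∣Order g
  p^[1+e]∣Order {p} {e} {g} p-prime gᵖᵉ⁺¹≈ε gᵖᵉ≉ε m gᵐ≈ε
    with ∣p^[1+e]⇒≡∨∣p^e p-prime e (gcd[m,n]∣n m (p ^ suc e))
  ... | inj₁ gcd≡pᵉ⁺¹ = ≡.subst (_∣ m) gcd≡pᵉ⁺¹ (gcd[m,n]∣m m (p ^ suc e))
  ... | inj₂ gcd∣pᵉ   = ⊥-elim (gᵖᵉ≉ε (^ᴳ≈ε-∣ gcd∣pᵉ (^ᴳ≈ε-gcd m (p ^ suc e) gᵐ≈ε gᵖᵉ⁺¹≈ε)))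

  exponent-attained : ∀ {p e} → Prime p → IsExponent G (p ^ e) → ∃ λ g → (p ^ e) ∣Order g
  exponent-attained {e = zero}  _       _ = ε , λ m _ → 1∣ m
  exponent-attained {p} {suc e} p-prime exponent@(_ , annihilates , _) =
    map₂ (λ {g} gᵖᵉ≉ε → p^[1+e]∣Order {e = e} p-prime (annihilates g) gᵖᵉ≉ε)
         (non-annihilated exponent (ℕ.m^n>0 p e) (ℕ.^-monoʳ-< p 1<p (ℕ.n<1+n e)))
    where
    instance _ = ℕ.nonTrivial⇒nonZero p {{prime⇒nonTrivial p-prime}}
    1<p : 1 < p
    1<p = ℕ.nonTrivial⇒n>1 p {{prime⇒nonTrivial p-prime}}

  module _ {E X g} (exponent : IsExponent G E) (E∣ord : E ∣Order g) (size≡E*X : size ≡ E * X) where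
    private
      E≢0 : E ≢ 0
      E≢0 = ℕ.n>0⇒n≢0 (proj₁ exponent)
      instance _ = ℕ.>-nonZero (proj₁ exponent)

    N[d]/d≤size/E : ∀ {d} → d ∣ E → frac (N G d) d ℚ.≤ ℕtoℚ X
    N[d]/d≤size/E {zero}  0∣E                = ⊥-elim (E≢0 (0∣⇒≡0 0∣E))
    N[d]/d≤size/E {suc _} (divides zero E≡0) = ⊥-elim (E≢0 E≡0)
    N[d]/d≤size/E {d@(suc b)} (divides k@(suc _) E≡kd) =
      frac≤ℕtoℚ (N G d) b X (ℕ.*-cancelʳ-≤ (N G d) (d * X) k (begin
        N G d * k   ≤⟨ N*k≤size E∣ord (≡.trans (ℕ.*-comm d k) (≡.sym E≡kd)) ⟩
        size        ≡⟨ size≡E*X ⟩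
        E * X       ≡⟨ ≡.cong (_* X) E≡kd ⟩
        k * d * X   ≡⟨ ℕ.*-assoc k d X ⟩
        k * (d * X) ≡⟨ ℕ.*-comm k (d * X) ⟩
        d * X * k   ∎))
      where open ℕ.≤-Reasoning

    NG≤τ[E]*size/E : NG G ℚ.≤ ℕtoℚ (τ E * X)
    NG≤τ[E]*size/E = ℚ.≤-trans
      (sumℚ-≤-count (_∣? E) (λ d → frac (N G d) d) X (λ _ → N[d]/d≤size/E) off-divisors (divisors size))
      (ℕtoℚ-mono-≤ (ℕ.*-monoˡ-≤ X (length-divisors-∣ (∣Order⇒≤size E∣ord))))
      where
      off-divisors : ∀ d → ¬ d ∣ E → frac (N G d) d ℚ.≤ ℕtoℚ 0
      off-divisors zero    _   = ℚ.≤-refl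
      off-divisors (suc b) d∤E = ≡.subst (λ n → frac n (suc b) ℚ.≤ ℕtoℚ 0)
        (≡.sym (N≡0 (proj₁ (proj₂ exponent)) d∤E)) (frac≤ℕtoℚ 0 b 0 z≤n)

mainTheorem5 : ∀ {c ℓ} (G : FiniteAbelianGroup c ℓ) (p n e : ℕ) → Prime p
    → FiniteAbelianGroup.size G ≡ p ^ n
    → IsExponent G (p ^ e)
    → ((j : ℕ) → j ≤ e → frac (N G (p ^ j)) (p ^ j) ℚ.≤ ℕtoℚ (p ^ (n ∸ e)))
    × (NG G ℚ.≤ ℕtoℚ (τ (p ^ e) * p ^ (n ∸ e)))
mainTheorem5 G p n e p-prime size≡pⁿ exponent with exponent-attained G {e = e} p-prime exponent
... | _ , pᵉ∣ord =
  (λ j j≤e → N[d]/d≤size/E G exponent pᵉ∣ord size≡ (^-monoʳ-∣ p j≤e)) ,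
  NG≤τ[E]*size/E G exponent pᵉ∣ord size≡
  where
  e≤n : e ≤ n
  e≤n = ^-cancelˡ-≤ (ℕ.nonTrivial⇒n>1 p {{prime⇒nonTrivial p-prime}})
          (≡.subst (p ^ e ≤_) size≡pⁿ (∣Order⇒≤size G pᵉ∣ord))
  size≡ : FiniteAbelianGroup.size G ≡ p ^ e * p ^ (n ∸ e)
  size≡ = ≡.trans size≡pⁿ (^-split p e≤n)
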